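{- Let $m \ge 1$ and $r \ge 1$ be integers. If there is a Gallai-Schur partition of the integer interval $[1,m]$ into $r$ non-empty subsets, then there is a Gallai-Schur partition of $[1,2m+1]$ into $r+1$ non-empty subsets, and there is a Gallai-Schur partition of $[1,5m+4]$ into $r+2$ non-empty subsets. The same statement holds with "Gallai-Schur partition" replaced throughout by "weak Gallai-Schur partition".
   Context: A partition of $[1,n]=\{1,2,\dots,n\}$ into $r$ non-empty disjoint subsets $S_1,\dots,S_r$ is a (strong) Gallai-Schur $r$-partition if (i) no subset $S_i$ contains integers $a,b,c$ (not necessarily distinct) with $a+b=c$, and (ii) there are no integers $a,b,c\in[1,n]$ with $a+b=c$ lying in three different subsets. It is a weak Gallai-Schur $r$-partition if (i) is replaced by: no subset contains three distinct integers $a,b,c$ with $a+b=c$ (so pairs $\{a,2a\}$ may lie in one subset), while (ii) is kept. -}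

module Defs where

open import Data.Nat using (ℕ; _+_; _≤_; _*_)
open import Data.Fin using (Fin)
open import Data.Product using (_×_; ∃-syntax)
open import Relation.Nullary using (¬_)
open import Relation.Binary.PropositionalEquality using (_≡_; _≢_)

-- An r-partition of [1,n] = {1,...,n} is encoded as a colouring
-- c : ℕ → Fin r, where S_i = { x ∈ [1,n] | c x ≡ i }.
-- Values of c outside [1,n] are irrelevant.

AllClassesNonEmpty : (n r : ℕ) → (ℕ → Fin r) → Set
AllClassesNonEmpty n r c = (i : Fin r) → ∃[ x ] (1 ≤ x × x ≤ n × c x ≡ i)

Rainbow : {r : ℕ} → (ℕ → Fin r) → ℕ → ℕ → Set
Rainbow c a b = c a ≢ c b × c a ≢ c (a + b) × c b ≢ c (a + b)

Mono : {r : ℕ} → (ℕ → Fin r) → ℕ → ℕ → Set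
Mono c a b = c a ≡ c b × c b ≡ c (a + b)

GallaiSchur : (n r : ℕ) → (ℕ → Fin r) → Set
GallaiSchur n r c =
  AllClassesNonEmpty n r c
  × (∀ a b → 1 ≤ a → 1 ≤ b → a + b ≤ n → ¬ Mono c a b)
  × (∀ a b → 1 ≤ a → 1 ≤ b → a + b ≤ n → ¬ Rainbow c a b)

-- weak Gallai-Schur r-partition of [1,n]: in (i) a, b, c must be distinct.
-- Since a, b ≥ 1, c = a + b is automatically distinct from a and b,
-- so distinctness amounts to a ≢ b.
WeakGallaiSchur : (n r : ℕ) → (ℕ → Fin r) → Set
WeakGallaiSchur n r c =
  AllClassesNonEmpty n r c
  × (∀ a b → 1 ≤ a → 1 ≤ b → a + b ≤ n → a ≢ b → ¬ Mono c a b)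
  × (∀ a b → 1 ≤ a → 1 ≤ b → a + b ≤ n → ¬ Rainbow c a b)

HasGS : ℕ → ℕ → Set
HasGS n r = ∃[ c ] GallaiSchur n r c

HasWeakGS : ℕ → ℕ → Set
HasWeakGS n r = ∃[ c ] WeakGallaiSchur n r c

module Submission where

-- Blow up by d: where c is a Gallai-Schur colouring of [1, n], colour x by c (x / d) if d ∣ x and by
-- one of e new colours ρ x otherwise; this colours [1, d n + d - 1]. A sum a + b = s with d dividing
-- all of a, b, s is d times a sum in [1, n]. If d divides some but not all of them, old and new
-- colours meet, so the triple is not monochromatic; nor is it rainbow as long as ρ is periodic
-- modulo d (if d divides one summand, the other summand and s are congruent) and symmetric (if d
-- divides only s, the summands are opposite residues). If d divides none of them, ρ itself must have
-- no monochromatic or rainbow sums. One colour does this for d = 2; for d = 5 two colours do, on the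
-- residue classes {±1} and {±2}, each of which is sum-free.

open import Defs
open import Data.Nat
  using (ℕ; suc; pred; _+_; _*_; _≤_; _<_; z≤n; s≤s; s≤s⁻¹; NonZero; >-nonZero; >-nonZero⁻¹)
open import Data.Nat.Properties
open import Data.Nat.DivMod using (_%_; m%n<n; m%n%n≡m%n; %-distribˡ-+; %-remove-+ˡ)
open import Data.Nat.Divisibility
open import Data.Fin using (Fin; _↑ˡ_; _↑ʳ_; splitAt)
open import Data.Fin.Patterns using (0F; 1F)
open import Data.Fin.Properties
  using (↑ˡ-injective; ↑ʳ-injective; splitAt-↑ˡ; splitAt-↑ʳ; splitAt⁻¹-↑ˡ; splitAt⁻¹-↑ʳ)
  renaming (_≟_ to _≟ᶠ_)
open import Data.Product using (_×_; _,_; ∃-syntax)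
open import Data.Sum using (inj₁; inj₂)
open import Function using (_∘_)
open import Relation.Nullary using (¬_; Dec; yes; no; contradiction; ¬?; _×-dec_; _→-dec_)
open import Relation.Nullary.Decidable using (from-yes)
open import Relation.Binary.PropositionalEquality

↑ˡ≢↑ʳ : ∀ {m n} (i : Fin m) (j : Fin n) → i ↑ˡ n ≢ m ↑ʳ j
↑ˡ≢↑ʳ {m} {n} i j eq
  with () ← trans (sym (splitAt-↑ˡ m i n)) (trans (cong (splitAt m) eq) (splitAt-↑ʳ m n j))

mono? : ∀ {r} (χ : ℕ → Fin r) a b → Dec (Mono χ a b)
mono? χ a b = (χ a ≟ᶠ χ b) ×-dec (χ b ≟ᶠ χ (a + b))

rainbow? : ∀ {r} (χ : ℕ → Fin r) a b → Dec (Rainbow χ a b)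
rainbow? χ a b = ¬? (χ a ≟ᶠ χ b) ×-dec ¬? (χ a ≟ᶠ χ (a + b)) ×-dec ¬? (χ b ≟ᶠ χ (a + b))

-- Only the values of ρ at non-multiples of d matter.
record GallaiSchurMod (d e : ℕ) (ρ : ℕ → Fin e) : Set where
  field
    covers      : ∀ k → ∃[ i ] (1 ≤ i × i < d × ρ i ≡ k)
    periodic    : ∀ a b → d ∣ a → ρ (a + b) ≡ ρ b
    symmetric   : ∀ a b → d ∤ a → d ∣ a + b → ρ a ≡ ρ b
    monoFree    : ∀ a b → d ∤ a → d ∤ b → d ∤ a + b → ¬ Mono ρ a b
    rainbowFree : ∀ a b → d ∤ a → d ∤ b → d ∤ a + b → ¬ Rainbow ρ a b

module BlowUp {d e : ℕ} .{{_ : NonZero d}} {ρ : ℕ → Fin e} (ρ-mod : GallaiSchurMod d e ρ)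
              {n r : ℕ} (c : ℕ → Fin r) where

  open GallaiSchurMod ρ-mod
    using (covers; periodic; symmetric)
    renaming (monoFree to ρ-monoFree; rainbowFree to ρ-rainbowFree)

  blowUp : ℕ → Fin (r + e)
  blowUp x with d ∣? x
  ... | yes (divides q _) = c q ↑ˡ e
  ... | no _              = r ↑ʳ ρ x

  blowUp-multiple : ∀ q → blowUp (q * d) ≡ c q ↑ˡ e
  blowUp-multiple q with d ∣? q * d
  ... | yes (divides q′ eq) = cong (λ t → c t ↑ˡ e) (*-cancelʳ-≡ q′ q d (sym eq))
  ... | no d∤qd             = contradiction (n∣m*n q) d∤qd

  blowUp-+ : ∀ p q → blowUp (p * d + q * d) ≡ c (p + q) ↑ˡ e
  blowUp-+ p q = trans (cong blowUp (sym (*-distribʳ-+ d p q))) (blowUp-multiple (p + q))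

  blowUp-nonMultiple : ∀ {x} → d ∤ x → blowUp x ≡ r ↑ʳ ρ x
  blowUp-nonMultiple {x} d∤x with d ∣? x
  ... | yes d∣x = contradiction d∣x d∤x
  ... | no _    = refl

  multiple≢nonMultiple : ∀ {x y} → d ∣ x → d ∤ y → blowUp x ≢ blowUp y
  multiple≢nonMultiple {y = y} (divides-refl q) d∤y eq =
    ↑ˡ≢↑ʳ (c q) (ρ y) (trans (sym (blowUp-multiple q)) (trans eq (blowUp-nonMultiple d∤y)))

  nonMultiple-injective : ∀ {x y} → d ∤ x → d ∤ y → blowUp x ≡ blowUp y → ρ x ≡ ρ y
  nonMultiple-injective d∤x d∤y eq =
    ↑ʳ-injective r _ _ (trans (sym (blowUp-nonMultiple d∤x)) (trans eq (blowUp-nonMultiple d∤y)))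

  nonMultiple-cong : ∀ {x y} → d ∤ x → d ∤ y → ρ x ≡ ρ y → blowUp x ≡ blowUp y
  nonMultiple-cong {x} {y} d∤x d∤y eq = begin
    blowUp x ≡⟨ blowUp-nonMultiple d∤x ⟩
    r ↑ʳ ρ x ≡⟨ cong (r ↑ʳ_) eq ⟩
    r ↑ʳ ρ y ≡⟨ blowUp-nonMultiple d∤y ⟨
    blowUp y ∎
    where open ≡-Reasoning

  Mono-blowUp⇒∣ : ∀ {a b} → Mono blowUp a b → d ∣ a × d ∣ b
  Mono-blowUp⇒∣ {a} {b} = cases (d ∣? a) (d ∣? b) (d ∣? a + b)
    where
    cases : Dec (d ∣ a) → Dec (d ∣ b) → Dec (d ∣ a + b) → Mono blowUp a b → d ∣ a × d ∣ b
    cases (yes d∣a) (yes d∣b) _ _ = d∣a , d∣b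
    cases (yes d∣a) (no d∤b) _ (ab , _) = contradiction ab (multiple≢nonMultiple d∣a d∤b)
    cases (no d∤a) (yes d∣b) _ (ab , _) = contradiction (sym ab) (multiple≢nonMultiple d∣b d∤a)
    cases (no d∤a) (no d∤b) (yes d∣a+b) (_ , b[a+b]) =
      contradiction (sym b[a+b]) (multiple≢nonMultiple d∣a+b d∤b)
    cases (no d∤a) (no d∤b) (no d∤a+b) (ab , b[a+b]) = contradiction
      (nonMultiple-injective d∤a d∤b ab , nonMultiple-injective d∤b d∤a+b b[a+b])
      (ρ-monoFree a b d∤a d∤b d∤a+b)

  Rainbow-blowUp⇒∣ : ∀ {a b} → Rainbow blowUp a b → d ∣ a × d ∣ b
  Rainbow-blowUp⇒∣ {a} {b} = cases (d ∣? a) (d ∣? b) (d ∣? a + b)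
    where
    cases : Dec (d ∣ a) → Dec (d ∣ b) → Dec (d ∣ a + b) → Rainbow blowUp a b → d ∣ a × d ∣ b
    cases (yes d∣a) (yes d∣b) _ _ = d∣a , d∣b
    cases (yes d∣a) (no d∤b) (yes d∣a+b) _ = contradiction (∣m+n∣m⇒∣n d∣a+b d∣a) d∤b
    cases (yes d∣a) (no d∤b) (no d∤a+b) (_ , _ , b≢a+b) =
      contradiction (nonMultiple-cong d∤b d∤a+b (sym (periodic a b d∣a))) b≢a+b
    cases (no d∤a) (yes d∣b) (yes d∣a+b) _ =
      contradiction (∣m+n∣m⇒∣n (subst (d ∣_) (+-comm a b) d∣a+b) d∣b) d∤a
    cases (no d∤a) (yes d∣b) (no d∤a+b) (_ , a≢a+b , _) =
      contradiction
        (nonMultiple-cong d∤a d∤a+b (sym (trans (cong ρ (+-comm a b)) (periodic b a d∣b))))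
        a≢a+b
    cases (no d∤a) (no d∤b) (yes d∣a+b) (a≢b , _) =
      contradiction (nonMultiple-cong d∤a d∤b (symmetric a b d∤a d∣a+b)) a≢b
    cases (no d∤a) (no d∤b) (no d∤a+b) (a≢b , a≢a+b , b≢a+b) = contradiction
      ( a≢b ∘ nonMultiple-cong d∤a d∤b
      , a≢a+b ∘ nonMultiple-cong d∤a d∤a+b
      , b≢a+b ∘ nonMultiple-cong d∤b d∤a+b )
      (ρ-rainbowFree a b d∤a d∤b d∤a+b)

  Mono-blowUp-multiples : ∀ p q → Mono blowUp (p * d) (q * d) → Mono c p q
  Mono-blowUp-multiples p q (pq , q[p+q])
    rewrite blowUp-multiple p | blowUp-multiple q | blowUp-+ p q =
    ↑ˡ-injective e _ _ pq , ↑ˡ-injective e _ _ q[p+q]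

  Rainbow-blowUp-multiples : ∀ p q → Rainbow blowUp (p * d) (q * d) → Rainbow c p q
  Rainbow-blowUp-multiples p q (p≢q , p≢p+q , q≢p+q)
    rewrite blowUp-multiple p | blowUp-multiple q | blowUp-+ p q =
    p≢q ∘ cong (_↑ˡ e) , p≢p+q ∘ cong (_↑ˡ e) , q≢p+q ∘ cong (_↑ˡ e)

  N : ℕ
  N = d * n + pred d

  1≤quotient : ∀ {q} → 1 ≤ q * d → 1 ≤ q
  1≤quotient {suc q} _ = s≤s z≤n

  quotients-≤ : ∀ p q → p * d + q * d ≤ N → p + q ≤ n
  quotients-≤ p q pd+qd≤N = s≤s⁻¹ (*-cancelʳ-< d (p + q) (suc n) (begin-strict
    (p + q) * d     ≡⟨ *-distribʳ-+ d p q ⟩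
    p * d + q * d   ≤⟨ pd+qd≤N ⟩
    d * n + pred d  <⟨ +-monoʳ-< (d * n) (≤-reflexive (suc-pred d)) ⟩
    d * n + d       ≡⟨ cong (_+ d) (*-comm d n) ⟩
    n * d + d       ≡⟨ +-comm (n * d) d ⟩
    suc n * d       ∎))
    where open ≤-Reasoning

  multiple-≤N : ∀ {x} → x ≤ n → x * d ≤ N
  multiple-≤N {x} x≤n = begin
    x * d ≤⟨ *-monoˡ-≤ d x≤n ⟩
    n * d ≡⟨ *-comm n d ⟩
    d * n ≤⟨ m≤m+n (d * n) (pred d) ⟩
    N     ∎
    where open ≤-Reasoning

  residue-≤N : ∀ {i} → i < d → i ≤ N
  residue-≤N i<d = ≤-trans (<⇒≤pred i<d) (m≤n+m (pred d) (d * n))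

  blowUp-nonEmpty : AllClassesNonEmpty n r c → AllClassesNonEmpty N (r + e) blowUp
  blowUp-nonEmpty nonEmpty k with splitAt r k in eq
  ... | inj₁ i with nonEmpty i
  ...   | x , 1≤x , x≤n , cx≡i =
    x * d , *-mono-≤ 1≤x (>-nonZero⁻¹ d) , multiple-≤N x≤n ,
    trans (blowUp-multiple x) (trans (cong (_↑ˡ e) cx≡i) (splitAt⁻¹-↑ˡ eq))
  blowUp-nonEmpty nonEmpty k | inj₂ j with covers j
  ...   | i , 1≤i , i<d , ρi≡j =
    i , 1≤i , residue-≤N i<d ,
    trans (blowUp-nonMultiple (>⇒∤ {{>-nonZero 1≤i}} i<d))
          (trans (cong (r ↑ʳ_) ρi≡j) (splitAt⁻¹-↑ʳ eq))

  blowUp-rainbowFree : (∀ p q → 1 ≤ p → 1 ≤ q → p + q ≤ n → ¬ Rainbow c p q) →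
                       ∀ a b → 1 ≤ a → 1 ≤ b → a + b ≤ N → ¬ Rainbow blowUp a b
  blowUp-rainbowFree rainbowFree a b 1≤a 1≤b a+b≤N rainbow with Rainbow-blowUp⇒∣ rainbow
  ... | divides-refl p , divides-refl q = rainbowFree p q (1≤quotient 1≤a) (1≤quotient 1≤b)
    (quotients-≤ p q a+b≤N) (Rainbow-blowUp-multiples p q rainbow)

  blowUp-monoFree : (∀ p q → 1 ≤ p → 1 ≤ q → p + q ≤ n → ¬ Mono c p q) →
                    ∀ a b → 1 ≤ a → 1 ≤ b → a + b ≤ N → ¬ Mono blowUp a b
  blowUp-monoFree monoFree a b 1≤a 1≤b a+b≤N mono with Mono-blowUp⇒∣ mono
  ... | divides-refl p , divides-refl q = monoFree p q (1≤quotient 1≤a) (1≤quotient 1≤b)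
    (quotients-≤ p q a+b≤N) (Mono-blowUp-multiples p q mono)

  blowUp-weakMonoFree : (∀ p q → 1 ≤ p → 1 ≤ q → p + q ≤ n → p ≢ q → ¬ Mono c p q) →
                        ∀ a b → 1 ≤ a → 1 ≤ b → a + b ≤ N → a ≢ b → ¬ Mono blowUp a b
  blowUp-weakMonoFree monoFree a b 1≤a 1≤b a+b≤N a≢b mono with Mono-blowUp⇒∣ mono
  ... | divides-refl p , divides-refl q = monoFree p q (1≤quotient 1≤a) (1≤quotient 1≤b)
    (quotients-≤ p q a+b≤N) (a≢b ∘ cong (_* d)) (Mono-blowUp-multiples p q mono)

  blowUp-gallaiSchur : GallaiSchur n r c → GallaiSchur N (r + e) blowUp
  blowUp-gallaiSchur (nonEmpty , monoFree , rainbowFree) =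
    blowUp-nonEmpty nonEmpty , blowUp-monoFree monoFree , blowUp-rainbowFree rainbowFree

  blowUp-weakGallaiSchur : WeakGallaiSchur n r c → WeakGallaiSchur N (r + e) blowUp
  blowUp-weakGallaiSchur (nonEmpty , monoFree , rainbowFree) =
    blowUp-nonEmpty nonEmpty , blowUp-weakMonoFree monoFree , blowUp-rainbowFree rainbowFree

module ResidueColouring {d e : ℕ} .{{_ : NonZero d}} (σ : ℕ → Fin e) where

  ρ : ℕ → Fin e
  ρ x = σ (x % d)

  ResidueConditions : Set
  ResidueConditions =
      (∀ {i} → i < d → ∀ {j} → j < d → d ∤ i → d ∣ i + j → ρ i ≡ ρ j)
    × (∀ {i} → i < d → ∀ {j} → j < d → d ∤ i → d ∤ j → d ∤ i + j → ¬ Mono ρ i j)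
    × (∀ {i} → i < d → ∀ {j} → j < d → d ∤ i → d ∤ j → d ∤ i + j → ¬ Rainbow ρ i j)

  residueConditions? : Dec ResidueConditions
  residueConditions? =
          allUpTo? (λ i → allUpTo? (λ j →
            ¬? (d ∣? i) →-dec d ∣? i + j →-dec ρ i ≟ᶠ ρ j) d) d
    ×-dec allUpTo? (λ i → allUpTo? (λ j →
            ¬? (d ∣? i) →-dec ¬? (d ∣? j) →-dec ¬? (d ∣? i + j) →-dec ¬? (mono? ρ i j)) d) d
    ×-dec allUpTo? (λ i → allUpTo? (λ j →
            ¬? (d ∣? i) →-dec ¬? (d ∣? j) →-dec ¬? (d ∣? i + j) →-dec ¬? (rainbow? ρ i j)) d) d

  ρ-% : ∀ a → ρ (a % d) ≡ ρ a
  ρ-% a = cong σ (m%n%n≡m%n a d)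

  ρ-%-+ : ∀ a b → ρ (a % d + b % d) ≡ ρ (a + b)
  ρ-%-+ a b = cong σ (sym (%-distribˡ-+ a b d))

  ∣%⇒∣ : ∀ {a} → d ∣ a % d → d ∣ a
  ∣%⇒∣ = ∣n∣m%n⇒∣m ∣-refl

  ∣⇒∣% : ∀ {a} → d ∣ a → d ∣ a % d
  ∣⇒∣% d∣a = %-presˡ-∣ d∣a ∣-refl

  ∤⇒∤% : ∀ {a} → d ∤ a → d ∤ a % d
  ∤⇒∤% d∤a = d∤a ∘ ∣%⇒∣

  ∣+⇒∣%+ : ∀ a b → d ∣ a + b → d ∣ a % d + b % d
  ∣+⇒∣%+ a b d∣a+b = ∣%⇒∣ (subst (d ∣_) (%-distribˡ-+ a b d) (∣⇒∣% d∣a+b))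

  ∤+⇒∤%+ : ∀ a b → d ∤ a + b → d ∤ a % d + b % d
  ∤+⇒∤%+ a b d∤a+b = d∤a+b ∘ ∣%⇒∣ ∘ subst (d ∣_) (sym (%-distribˡ-+ a b d)) ∘ ∣⇒∣%

  triple-% : ∀ (T : Fin e → Fin e → Fin e → Set) a b →
             T (ρ a) (ρ b) (ρ (a + b)) → T (ρ (a % d)) (ρ (b % d)) (ρ (a % d + b % d))
  triple-% T a b t rewrite ρ-% a | ρ-% b | ρ-%-+ a b = t

  gallaiSchurMod : (∀ k → ∃[ i ] (1 ≤ i × i < d × ρ i ≡ k)) → ResidueConditions →
                   GallaiSchurMod d e ρ
  gallaiSchurMod covers (symmetric , monoFree , rainbowFree) = record
    { covers      = covers
    ; periodic    = λ a b d∣a → cong σ (%-remove-+ˡ b d∣a)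
    ; symmetric   = λ a b d∤a d∣a+b → begin
        ρ a         ≡⟨ ρ-% a ⟨
        ρ (a % d)   ≡⟨ symmetric (m%n<n a d) (m%n<n b d) (∤⇒∤% d∤a) (∣+⇒∣%+ a b d∣a+b) ⟩
        ρ (b % d)   ≡⟨ ρ-% b ⟩
        ρ b         ∎
    ; monoFree    = λ a b d∤a d∤b d∤a+b mono →
        monoFree (m%n<n a d) (m%n<n b d) (∤⇒∤% d∤a) (∤⇒∤% d∤b) (∤+⇒∤%+ a b d∤a+b)
          (triple-% (λ x y z → x ≡ y × y ≡ z) a b mono)
    ; rainbowFree = λ a b d∤a d∤b d∤a+b rainbow →
        rainbowFree (m%n<n a d) (m%n<n b d) (∤⇒∤% d∤a) (∤⇒∤% d∤b) (∤+⇒∤%+ a b d∤a+b)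
          (triple-% (λ x y z → x ≢ y × x ≢ z × y ≢ z) a b rainbow)
    }
    where open ≡-Reasoning

σ₂ : ℕ → Fin 1
σ₂ _ = 0F

gallaiSchurMod₂ : GallaiSchurMod 2 1 (ResidueColouring.ρ {d = 2} σ₂)
gallaiSchurMod₂ = gallaiSchurMod covers (from-yes residueConditions?)
  where
  open ResidueColouring {d = 2} σ₂
  covers : ∀ k → ∃[ i ] (1 ≤ i × i < 2 × ρ i ≡ k)
  covers 0F = 1 , s≤s z≤n , s≤s (s≤s z≤n) , refl

σ₅ : ℕ → Fin 2
σ₅ 2 = 1F
σ₅ 3 = 1F
σ₅ _ = 0F

gallaiSchurMod₅ : GallaiSchurMod 5 2 (ResidueColouring.ρ {d = 5} σ₅)
gallaiSchurMod₅ = gallaiSchurMod covers (from-yes residueConditions?)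
  where
  open ResidueColouring {d = 5} σ₅
  covers : ∀ k → ∃[ i ] (1 ≤ i × i < 5 × ρ i ≡ k)
  covers 0F = 1 , s≤s z≤n , s≤s (s≤s z≤n) , refl
  covers 1F = 2 , s≤s z≤n , s≤s (s≤s (s≤s z≤n)) , refl

module _ {d e : ℕ} .{{_ : NonZero d}} {ρ : ℕ → Fin e} (ρ-mod : GallaiSchurMod d e ρ)
         {n r : ℕ} where

  blowUp-HasGS : HasGS n r → HasGS (d * n + pred d) (r + e)
  blowUp-HasGS (c , gs) = _ , BlowUp.blowUp-gallaiSchur ρ-mod c gs

  blowUp-HasWeakGS : HasWeakGS n r → HasWeakGS (d * n + pred d) (r + e)
  blowUp-HasWeakGS (c , gs) = _ , BlowUp.blowUp-weakGallaiSchur ρ-mod c gs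

theorem1 : (m r : ℕ) → 1 ≤ m → 1 ≤ r →
    (HasGS m r → HasGS (2 * m + 1) (r + 1) × HasGS (5 * m + 4) (r + 2))
    × (HasWeakGS m r → HasWeakGS (2 * m + 1) (r + 1) × HasWeakGS (5 * m + 4) (r + 2))
theorem1 m r _ _ =
    (λ gs → blowUp-HasGS gallaiSchurMod₂ gs , blowUp-HasGS gallaiSchurMod₅ gs)
  , (λ gs → blowUp-HasWeakGS gallaiSchurMod₂ gs , blowUp-HasWeakGS gallaiSchurMod₅ gs)
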